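{- Let $n\in\mathbb{Z}^+$ and let $\phi:\mathbb{B}^n\to\mathbb{B}$ be given as a DNF with $k$ conjunctive clauses each containing at most three literals, $\phi(\mathbf{y})=\bigvee_{j=1}^k c_j(\mathbf{y})$. Define the Boolean network $f:\mathbb{B}^{n+2k+2}\to\mathbb{B}^{n+2k+2}$ by $f_i(\mathbf{x})=(\mathbf{x}_i\wedge\neg\mathbf{x}_{n+2k+1})\vee\mathbf{x}_{n+2k+2}$ for $i\in[1,n]$; $f_{n+j}(\mathbf{x})=(c_j(\mathbf{x}_{[1,n]})\wedge\neg\mathbf{x}_{n+2k+1})\vee\mathbf{x}_{n+2k+2}$ for $j\in[1,k]$; $f_{n+k+1}(\mathbf{x})=\mathbf{x}_{n+1}$; $f_{n+k+j}(\mathbf{x})=\mathbf{x}_{n+j}\vee\mathbf{x}_{n+k+j-1}$ for $j\in[2,k]$; $f_{n+2k+1}(\mathbf{x})=\mathbf{x}_{n+2k}\wedge\neg\mathbf{x}_{n+2k+2}$; $f_{n+2k+2}(\mathbf{x})=\mathbf{x}_{n+2k+1}\wedge\neg\mathbf{x}_{n+2k+2}$. Then $\forall\mathbf{y}\,\phi(\mathbf{y})$ is true if and only if $*^{n+2k+2}$ is the unique minimal trap space of $f$.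
   Context: $\mathbb{B}=\{0,1\}$, $[a,b]=\{a,\dots,b\}$, $\mathbf{x}_{[a,b]}=(\mathbf{x}_a,\dots,\mathbf{x}_b)$. A DNF is a disjunction of conjunctive clauses, each a conjunction of literals (variables or negated variables). A Boolean network of dimension $m$ is a map $f:\mathbb{B}^m\to\mathbb{B}^m$ with local functions $f_i$. A sub-hypercube is a vector $\mathbf{h}\in\{0,1,*\}^m$ with vertex set $v(\mathbf{h})=\{\mathbf{x}\in\mathbb{B}^m:\forall i,\ \mathbf{h}_i\neq *\Rightarrow\mathbf{x}_i=\mathbf{h}_i\}$. A trap space of $f$ is a sub-hypercube $\mathbf{h}$ with $f(\mathbf{x})\in v(\mathbf{h})$ for all $\mathbf{x}\in v(\mathbf{h})$; it is minimal if there is no trap space $\mathbf{h}'$ with $v(\mathbf{h}')\subsetneq v(\mathbf{h})$. $*^m$ is the sub-hypercube with all entries $*$. -}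

module Defs where

open import Data.Nat using (ℕ; zero; suc; _+_; _≤_; s≤s; z≤n)
open import Data.Fin using (Fin; zero; suc; _↑ˡ_; _↑ʳ_; splitAt; inject₁; fromℕ)
open import Data.Bool using (Bool; true; false; _∧_; _∨_; not; if_then_else_)
open import Data.Maybe using (Maybe; just; nothing)
open import Data.List using (List; length; foldr)
open import Data.Sum using (_⊎_; inj₁; inj₂)
open import Data.Product using (_×_; Σ; ∃)
open import Relation.Binary.PropositionalEquality using (_≡_)
open import Relation.Nullary using (¬_)

-- A literal over variables y_1..y_n: a variable index together with a
-- polarity (true = positive literal y_i, false = negated literal ¬ y_i).
Literal : ℕ → Set
Literal n = Fin n × Bool

Clause : ℕ → Set
Clause n = List (Literal n)

DNF : ℕ → ℕ → Set
DNF n k = Fin k → Clause n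

evalLit : ∀ {n} → Literal n → (Fin n → Bool) → Bool
evalLit (i Data.Product., true) y = y i
evalLit (i Data.Product., false) y = not (y i)

evalClause : ∀ {n} → Clause n → (Fin n → Bool) → Bool
evalClause c y = foldr (λ l b → evalLit l y ∧ b) true c

evalDNF : ∀ {n k} → DNF n k → (Fin n → Bool) → Bool
evalDNF {k = zero} φ y = false
evalDNF {k = suc k} φ y = evalClause (φ zero) y ∨ evalDNF {k = k} (λ j → φ (suc j)) y

At-most-3 : ∀ {n k} → DNF n k → Set
At-most-3 φ = ∀ j → length (φ j) ≤ 3

State : ℕ → Set
State m = Fin m → Bool

BN : ℕ → Set
BN m = State m → State m

-- sub-hypercube h ∈ {0,1,*}^m, with nothing = *
SubHypercube : ℕ → Set
SubHypercube m = Fin m → Maybe Bool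

star : ∀ {m} → SubHypercube m
star i = nothing

_∈v_ : ∀ {m} → State m → SubHypercube m → Set
x ∈v h = ∀ i b → h i ≡ just b → x i ≡ b

_⊆v_ : ∀ {m} → SubHypercube m → SubHypercube m → Set
h' ⊆v h = ∀ x → x ∈v h' → x ∈v h

_⊊v_ : ∀ {m} → SubHypercube m → SubHypercube m → Set
h' ⊊v h = h' ⊆v h × ∃ λ x → x ∈v h × ¬ (x ∈v h')

IsTrapSpace : ∀ {m} → BN m → SubHypercube m → Set
IsTrapSpace f h = ∀ x → x ∈v h → f x ∈v h

IsMinimalTrapSpace : ∀ {m} → BN m → SubHypercube m → Set
IsMinimalTrapSpace f h =
  IsTrapSpace f h × (∀ h' → IsTrapSpace f h' → ¬ (h' ⊊v h))

StarUniqueMinimal : ∀ {m} → BN m → Set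
StarUniqueMinimal {m} f =
  IsMinimalTrapSpace f star ×
  (∀ h → IsMinimalTrapSpace f h → ∀ i → h i ≡ star i)

-- Dimension n + k + k + 2 (= n + 2k + 2).
-- 0-based Fin positions vs. the paper's 1-based indices:
--   varPos i     (i : Fin n)  ↔ x_{i+1}          (i+1 ∈ [1,n])
--   clausePos j  (j : Fin k)  ↔ x_{n+j+1}
--   chainPos j   (j : Fin k)  ↔ x_{n+k+j+1}
--   posA                      ↔ x_{n+2k+1}
--   posB                      ↔ x_{n+2k+2}

module _ {n k : ℕ} where
  Dim : ℕ
  Dim = n + k + k + 2

  varPos : Fin n → Fin Dim
  varPos i = ((i ↑ˡ k) ↑ˡ k) ↑ˡ 2

  clausePos : Fin k → Fin Dim
  clausePos j = ((n ↑ʳ j) ↑ˡ k) ↑ˡ 2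

  chainPos : Fin k → Fin Dim
  chainPos j = ((n + k) ↑ʳ j) ↑ˡ 2

  posA : Fin Dim
  posA = (n + k + k) ↑ʳ zero

  posB : Fin Dim
  posB = (n + k + k) ↑ʳ suc zero

-- The network f of the lemma (defined for k ≥ 1, as the construction
-- requires: f_{n+k+1} = x_{n+1} and f_{n+2k+1} mention x_{n+1}, x_{n+2k}).
network : ∀ {n k} → 1 ≤ k → DNF n k → BN (n + k + k + 2)
network {n} {suc k} (s≤s z≤n) φ x i with splitAt (n + suc k + suc k) i
... | inj₂ zero = x (chainPos {n} {suc k} (fromℕ k)) ∧ not (x (posB {n} {suc k}))
... | inj₂ (suc zero) = x (posA {n} {suc k}) ∧ not (x (posB {n} {suc k}))
... | inj₁ i₁ with splitAt (n + suc k) i₁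
...   | inj₂ zero = x (clausePos {n} {suc k} zero)
...   | inj₂ (suc j) = x (clausePos {n} {suc k} (suc j)) ∨ x (chainPos {n} {suc k} (inject₁ j))
...   | inj₁ i₂ with splitAt n i₂
...     | inj₁ v = (x (varPos {n} {suc k} v) ∧ not (x (posA {n} {suc k}))) ∨ x (posB {n} {suc k})
...     | inj₂ j = (evalClause (φ j) (λ v → x (varPos {n} {suc k} v)) ∧ not (x (posA {n} {suc k}))) ∨ x (posB {n} {suc k})

{-# OPTIONS --safe #-}

-- Write A = x_{n+2k+1} and B = x_{n+2k+2}. In a trap space B is never fixed at 1 (from B = 1
-- the network resets B to 0), fixing B forces A to be fixed at 0, and A is never fixed at 1.
-- If A is free then so is B, and the points of the trap space with B = 1 (all gated
-- coordinates switch on) and with A = 1, B = 0 (they switch off) leave no other coordinate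
-- fixed; the chain is freed from left to right. If A is fixed at 0, take the point of the
-- trap space that is 1 wherever allowed: the last chain node must be 0, this propagates back
-- through the chain to every clause node, and then the variable part of the point falsifies
-- φ. Conversely a falsifying y yields the fixed point (y, 0, …, 0), a trap space strictly
-- inside *^m.

module Submission where

open import Defs
open import Data.Bool using (Bool; true; false; _∧_; _∨_; not)
open import Data.Bool.Properties using (∧-identityʳ; ∧-zeroʳ; ∨-identityʳ; ∨-zeroʳ; ∨-conicalˡ; ∨-conicalʳ; not-¬)
open import Data.Empty using (⊥-elim)
open import Data.Fin using (Fin; zero; suc; _↑ˡ_; _↑ʳ_; splitAt; inject₁; fromℕ)
open import Data.Fin.Induction using (<-weakInduction; >-weakInduction)
open import Data.Fin.Properties using (splitAt-↑ˡ; splitAt-↑ʳ; splitAt⁻¹-↑ˡ; splitAt⁻¹-↑ʳ)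
open import Data.List using ([]; _∷_)
open import Data.Maybe using (just; nothing; fromMaybe)
open import Data.Nat using (ℕ; zero; suc; _+_; _≤_; s≤s; z≤n)
open import Data.Product using (Σ; _,_; proj₁)
open import Data.Sum using (inj₁; inj₂)
open import Data.Vec.Functional using (_++_)
open import Function using (const; case_of_)
open import Function.Bundles using (_⇔_; mk⇔)
open import Relation.Binary.PropositionalEquality
open import Relation.Nullary using (¬_)
open ≡-Reasoning

evalLit-cong : ∀ {n} (l : Literal n) {y z : Fin n → Bool} → (∀ v → y v ≡ z v) → evalLit l y ≡ evalLit l z
evalLit-cong (i , true) y≗z = y≗z i
evalLit-cong (i , false) y≗z = cong not (y≗z i)

evalClause-cong : ∀ {n} (c : Clause n) {y z : Fin n → Bool} → (∀ v → y v ≡ z v) → evalClause c y ≡ evalClause c z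
evalClause-cong [] y≗z = refl
evalClause-cong (l ∷ c) y≗z = cong₂ _∧_ (evalLit-cong l y≗z) (evalClause-cong c y≗z)

clauses-false⇒evalDNF-false : ∀ {n k} (φ : DNF n k) {y} → (∀ j → evalClause (φ j) y ≡ false) → evalDNF φ y ≡ false
clauses-false⇒evalDNF-false {k = zero} φ cs = refl
clauses-false⇒evalDNF-false {k = suc k} φ cs = cong₂ _∨_ (cs zero) (clauses-false⇒evalDNF-false (λ j → φ (suc j)) (λ j → cs (suc j)))

evalDNF-false⇒clause : ∀ {n k} (φ : DNF n k) y → evalDNF φ y ≡ false → ∀ j → evalClause (φ j) y ≡ false
evalDNF-false⇒clause φ y φy zero = ∨-conicalˡ _ _ φy
evalDNF-false⇒clause φ y φy (suc j) = evalDNF-false⇒clause (λ j → φ (suc j)) y (∨-conicalʳ _ _ φy) j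

data Split (m n : ℕ) : Fin (m + n) → Set where
  left  : ∀ i → Split m n (i ↑ˡ n)
  right : ∀ j → Split m n (m ↑ʳ j)

split : ∀ m {n} (i : Fin (m + n)) → Split m n i
split m i with splitAt m i in eq
... | inj₁ i′ = subst (Split m _) (splitAt⁻¹-↑ˡ eq) (left i′)
... | inj₂ j = subst (Split m _) (splitAt⁻¹-↑ʳ eq) (right j)

module _ {m : ℕ} where

  pick : SubHypercube m → State m → State m
  pick h d i = fromMaybe (d i) (h i)

  pick-∈v : ∀ h d → pick h d ∈v h
  pick-∈v h d i b hᵢ rewrite hᵢ = refl

  pick-free : ∀ h d {i} → h i ≡ nothing → pick h d i ≡ d i
  pick-free h d hᵢ rewrite hᵢ = refl

  pick-flipped⇒fixed : ∀ h d {i b} → pick h d i ≡ b → d i ≡ not b → h i ≡ just b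
  pick-flipped⇒fixed h d {i} pᵢ dᵢ with h i
  ... | just _ = cong just pᵢ
  ... | nothing = ⊥-elim (not-¬ pᵢ dᵢ)

  module _ {f : BN m} {h : SubHypercube m} (trap : IsTrapSpace f h) where

    trap-pick-flipped : ∀ d {i b} → pick h d i ≡ b → d i ≡ not b → f (pick h d) i ≡ b
    trap-pick-flipped d pᵢ dᵢ = trap (pick h d) (pick-∈v h d) _ _ (pick-flipped⇒fixed h d pᵢ dᵢ)

    trap-images-differ⇒free : ∀ {x y} → x ∈v h → y ∈v h → ∀ {i} → f x i ≢ f y i → h i ≡ nothing
    trap-images-differ⇒free x∈h y∈h {i} fxᵢ≢fyᵢ with h i in hᵢ
    ... | just b = ⊥-elim (fxᵢ≢fyᵢ (trans (trap _ x∈h i b hᵢ) (sym (trap _ y∈h i b hᵢ))))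
    ... | nothing = refl

  module _ {f : BN m} where

    all-free⇒starUniqueMinimal : (∀ h → IsTrapSpace f h → ∀ i → h i ≡ nothing) → StarUniqueMinimal f
    all-free⇒starUniqueMinimal all-free = ((λ _ _ _ _ ()) , minimal) , λ h h-min → all-free h (proj₁ h-min)
      where
      minimal : ∀ h → IsTrapSpace f h → ¬ (h ⊊v star)
      minimal h trap (_ , _ , _ , x∉h) = x∉h λ i b hᵢ → case trans (sym (all-free h trap i)) hᵢ of λ ()

    starMinimal⇒trap-unfixed : IsMinimalTrapSpace f star → ∀ {h} → IsTrapSpace f h → ∀ {i b} → h i ≢ just b
    starMinimal⇒trap-unfixed (_ , minimal) {h} trap {i} {b} hᵢ =
      minimal h trap ((λ _ _ _ _ ()) , const (not b) , (λ _ _ ()) , λ x∈h → not-¬ refl (sym (x∈h i b hᵢ)))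

module Network {n k : ℕ} (φ : DNF n (suc k)) where

  K : ℕ
  K = suc k

  Point : Set
  Point = State (n + K + K + 2)

  var : Fin n → Fin (n + K + K + 2)
  var = varPos {n} {K}

  clause chain : Fin K → Fin (n + K + K + 2)
  clause = clausePos {n} {K}
  chain = chainPos {n} {K}

  A B : Fin (n + K + K + 2)
  A = posA {n} {K}
  B = posB {n} {K}

  data Coordinate : Fin (n + K + K + 2) → Set where
    at-var : ∀ v → Coordinate (var v)
    at-clause : ∀ j → Coordinate (clause j)
    at-chain : ∀ j → Coordinate (chain j)
    at-A : Coordinate A
    at-B : Coordinate B

  coordinate : ∀ i → Coordinate i
  coordinate i with split (n + K + K) i
  ... | right zero = at-A
  ... | right (suc zero) = at-B
  ... | left i₁ with split (n + K) i₁
  ...   | right j = at-chain j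
  ...   | left i₂ with split n i₂
  ...     | left v = at-var v
  ...     | right j = at-clause j

  state : (Fin n → Bool) → Bool → Bool → Bool → Point
  state y c a b = ((y ++ const c) ++ const c) ++ λ { zero → a ; (suc _) → b }

  module _ {y : Fin n → Bool} {c a b : Bool} where

    state-var : ∀ v → state y c a b (var v) ≡ y v
    state-var v rewrite splitAt-↑ˡ (n + K + K) ((v ↑ˡ K) ↑ˡ K) 2 | splitAt-↑ˡ (n + K) (v ↑ˡ K) K | splitAt-↑ˡ n v K = refl

    state-clause : ∀ j → state y c a b (clause j) ≡ c
    state-clause j rewrite splitAt-↑ˡ (n + K + K) ((n ↑ʳ j) ↑ˡ K) 2 | splitAt-↑ˡ (n + K) (n ↑ʳ j) K | splitAt-↑ʳ n K j = refl

    state-chain : ∀ j → state y c a b (chain j) ≡ c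
    state-chain j rewrite splitAt-↑ˡ (n + K + K) ((n + K) ↑ʳ j) 2 | splitAt-↑ʳ (n + K) K j = refl

    state-A : state y c a b A ≡ a
    state-A rewrite splitAt-↑ʳ (n + K + K) 2 zero = refl

    state-B : state y c a b B ≡ b
    state-B rewrite splitAt-↑ʳ (n + K + K) 2 (suc zero) = refl

  uniform : Bool → Bool → Bool → Point
  uniform c = state (const c) c

  F : BN (n + K + K + 2)
  F = network (s≤s z≤n) φ

  vars : Point → Fin n → Bool
  vars x v = x (var v)

  module _ (x : Point) where

    F-var : ∀ v → F x (var v) ≡ (x (var v) ∧ not (x A)) ∨ x B
    F-var v rewrite splitAt-↑ˡ (n + K + K) ((v ↑ˡ K) ↑ˡ K) 2 | splitAt-↑ˡ (n + K) (v ↑ˡ K) K | splitAt-↑ˡ n v K = refl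

    F-clause : ∀ j → F x (clause j) ≡ (evalClause (φ j) (vars x) ∧ not (x A)) ∨ x B
    F-clause j rewrite splitAt-↑ˡ (n + K + K) ((n ↑ʳ j) ↑ˡ K) 2 | splitAt-↑ˡ (n + K) (n ↑ʳ j) K | splitAt-↑ʳ n K j = refl

    F-chain-zero : F x (chain zero) ≡ x (clause zero)
    F-chain-zero rewrite splitAt-↑ˡ (n + K + K) ((n + K) ↑ʳ zero {k}) 2 | splitAt-↑ʳ (n + K) K zero = refl

    F-chain-suc : ∀ j → F x (chain (suc j)) ≡ x (clause (suc j)) ∨ x (chain (inject₁ j))
    F-chain-suc j rewrite splitAt-↑ˡ (n + K + K) ((n + K) ↑ʳ suc j) 2 | splitAt-↑ʳ (n + K) K (suc j) = refl

    F-A : F x A ≡ x (chain (fromℕ k)) ∧ not (x B)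
    F-A rewrite splitAt-↑ʳ (n + K + K) 2 zero = refl

    F-B : F x B ≡ x A ∧ not (x B)
    F-B rewrite splitAt-↑ʳ (n + K + K) 2 (suc zero) = refl

  module _ {h : SubHypercube (n + K + K + 2)} (trap : IsTrapSpace F h) where

    B≢true : h B ≢ just true
    B≢true hB = case B-value of λ ()
      where
      x : Point
      x = pick h (const false)
      B-value : true ≡ false
      B-value = begin
        true             ≡⟨ trap x (pick-∈v h _) B true hB ⟨
        F x B            ≡⟨ F-B x ⟩
        x A ∧ not (x B)  ≡⟨ cong (λ b → x A ∧ not b) (pick-∈v h _ B true hB) ⟩
        x A ∧ false      ≡⟨ ∧-zeroʳ (x A) ⟩
        false            ∎

    B-fixed⇒A-false : ∀ {b} → h B ≡ just b → h A ≡ just false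
    B-fixed⇒A-false {true} hB = ⊥-elim (B≢true hB)
    B-fixed⇒A-false {false} hB = pick-flipped⇒fixed h d A-value state-A
      where
      d x : Point
      d = uniform false true false
      x = pick h d
      A-value : x A ≡ false
      A-value = begin
        x A              ≡⟨ ∧-identityʳ (x A) ⟨
        x A ∧ true       ≡⟨ cong (λ b → x A ∧ not b) (pick-∈v h d B false hB) ⟨
        x A ∧ not (x B)  ≡⟨ F-B x ⟨
        F x B            ≡⟨ trap x (pick-∈v h d) B false hB ⟩
        false            ∎

    A-free⇒B-free : h A ≡ nothing → h B ≡ nothing
    A-free⇒B-free hA with h B in hB
    ... | just _ = case trans (sym hA) (B-fixed⇒A-false hB) of λ ()
    ... | nothing = refl

    A≢true : h A ≢ just true
    A≢true hA with h B in hB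
    ... | just _ = case trans (sym hA) (B-fixed⇒A-false hB) of λ ()
    ... | nothing = case A-value of λ ()
      where
      d x : Point
      d = uniform true false true
      x = pick h d
      A-value : true ≡ false
      A-value = begin
        true                                   ≡⟨ trap x (pick-∈v h d) A true hA ⟨
        F x A                                  ≡⟨ F-A x ⟩
        x (chain (fromℕ k)) ∧ not (x B)        ≡⟨ cong (λ b → x (chain (fromℕ k)) ∧ not b) (trans (pick-free h d hB) state-B) ⟩
        x (chain (fromℕ k)) ∧ false            ≡⟨ ∧-zeroʳ _ ⟩
        false                                  ∎

    -- A point of the trap space that is 0 where d is 1 sits on a fixed coordinate, so F keeps it 0.
    module _ (hA : h A ≡ just false) where
      private
        d x : Point
        d = uniform true false false
        x = pick h d

        xA : x A ≡ false
        xA = pick-∈v h d A false hA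

        xB : x B ≡ false
        xB with h B in hB
        ... | just true = ⊥-elim (B≢true hB)
        ... | just false = refl
        ... | nothing = state-B

        last-off : x (chain (fromℕ k)) ≡ false
        last-off = begin
          x (chain (fromℕ k))                ≡⟨ ∧-identityʳ _ ⟨
          x (chain (fromℕ k)) ∧ true         ≡⟨ cong (λ b → x (chain (fromℕ k)) ∧ not b) xB ⟨
          x (chain (fromℕ k)) ∧ not (x B)    ≡⟨ F-A x ⟨
          F x A                              ≡⟨ trap x (pick-∈v h d) A false hA ⟩
          false                              ∎

        chain-suc-off : ∀ j → x (chain (suc j)) ≡ false → x (clause (suc j)) ∨ x (chain (inject₁ j)) ≡ false
        chain-suc-off j off = trans (sym (F-chain-suc x j)) (trap-pick-flipped trap d off (state-chain _))

        chain-off : ∀ j → x (chain j) ≡ false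
        chain-off = >-weakInduction _ last-off λ j off → ∨-conicalʳ _ _ (chain-suc-off j off)

        clause-off : ∀ j → x (clause j) ≡ false
        clause-off zero = trans (sym (F-chain-zero x)) (trap-pick-flipped trap d (chain-off zero) (state-chain _))
        clause-off (suc j) = ∨-conicalˡ _ _ (chain-suc-off j (chain-off (suc j)))

        clause-falsified : ∀ j → evalClause (φ j) (vars x) ≡ false
        clause-falsified j = begin
          e                          ≡⟨ ∧-identityʳ e ⟨
          e ∧ true                   ≡⟨ ∨-identityʳ _ ⟨
          (e ∧ true) ∨ false         ≡⟨ cong₂ (λ a b → (e ∧ not a) ∨ b) xA xB ⟨
          (e ∧ not (x A)) ∨ x B      ≡⟨ F-clause x j ⟨
          F x (clause j)             ≡⟨ trap-pick-flipped trap d (clause-off j) (state-clause j) ⟩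
          false                      ∎
          where e = evalClause (φ j) (vars x)

      A-off⇒falsifiable : Σ (Fin n → Bool) λ y → evalDNF φ y ≡ false
      A-off⇒falsifiable = vars x , clauses-false⇒evalDNF-false φ clause-falsified

    module _ (hA : h A ≡ nothing) where
      private
        hB : h B ≡ nothing
        hB = A-free⇒B-free hA

        d₁ d₂ x₁ x₂ : Point
        d₁ = uniform true false true
        d₂ = uniform false true false
        x₁ = pick h d₁
        x₂ = pick h d₂

        x₁∈h : x₁ ∈v h
        x₁∈h = pick-∈v h d₁

        x₂∈h : x₂ ∈v h
        x₂∈h = pick-∈v h d₂

        free₁ : ∀ {i} → h i ≡ nothing → x₁ i ≡ d₁ i
        free₁ = pick-free h d₁

        free₂ : ∀ {i} → h i ≡ nothing → x₂ i ≡ d₂ i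
        free₂ = pick-free h d₂

        x₁B : x₁ B ≡ true
        x₁B = trans (free₁ hB) state-B

        x₂A : x₂ A ≡ true
        x₂A = trans (free₂ hA) state-A

        x₂B : x₂ B ≡ false
        x₂B = trans (free₂ hB) state-B

        gated-free : ∀ {i} (g : Point → Bool) → (∀ x → F x i ≡ (g x ∧ not (x A)) ∨ x B) → h i ≡ nothing
        gated-free {i} g Fᵢ = trap-images-differ⇒free trap x₁∈h x₂∈h λ on≡off → case trans (sym on) (trans on≡off off) of λ ()
          where
          on : F x₁ i ≡ true
          on rewrite Fᵢ x₁ | x₁B = ∨-zeroʳ _
          off : F x₂ i ≡ false
          off rewrite Fᵢ x₂ | x₂A | x₂B | ∧-zeroʳ (g x₂) = refl

        var-free : ∀ v → h (var v) ≡ nothing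
        var-free v = gated-free (λ x → x (var v)) (λ x → F-var x v)

        clause-free : ∀ j → h (clause j) ≡ nothing
        clause-free j = gated-free (λ x → evalClause (φ j) (vars x)) (λ x → F-clause x j)

        clause₁ : ∀ j → x₁ (clause j) ≡ true
        clause₁ j = trans (free₁ (clause-free j)) (state-clause j)

        clause₂ : ∀ j → x₂ (clause j) ≡ false
        clause₂ j = trans (free₂ (clause-free j)) (state-clause j)

        chain-on : ∀ j → F x₁ (chain j) ≡ true
        chain-on zero = trans (F-chain-zero x₁) (clause₁ zero)
        chain-on (suc j) = trans (F-chain-suc x₁ j) (cong (_∨ x₁ (chain (inject₁ j))) (clause₁ (suc j)))

        chain≢true : ∀ j → h (chain j) ≢ just true
        chain≢true = <-weakInduction _ chain-zero≢true chain-suc≢true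
          where
          chain-zero≢true : h (chain zero) ≢ just true
          chain-zero≢true hc = case trans (sym (trap x₂ x₂∈h _ true hc)) (trans (F-chain-zero x₂) (clause₂ zero)) of λ ()
          chain-suc≢true : ∀ j → h (chain (inject₁ j)) ≢ just true → h (chain (suc j)) ≢ just true
          chain-suc≢true j ih hc = ih (pick-flipped⇒fixed h d₂ previous-on (state-chain _))
            where
            previous-on : x₂ (chain (inject₁ j)) ≡ true
            previous-on = begin
              x₂ (chain (inject₁ j))                            ≡⟨ cong (_∨ x₂ (chain (inject₁ j))) (clause₂ (suc j)) ⟨
              x₂ (clause (suc j)) ∨ x₂ (chain (inject₁ j))      ≡⟨ F-chain-suc x₂ j ⟨
              F x₂ (chain (suc j))                              ≡⟨ trap x₂ x₂∈h _ true hc ⟩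
              true                                              ∎

        chain-free : ∀ j → h (chain j) ≡ nothing
        chain-free j with h (chain j) in hc
        ... | just b = ⊥-elim (chain≢true j (trans hc (cong just (trans (sym (trap x₁ x₁∈h _ b hc)) (chain-on j)))))
        ... | nothing = refl

      A-free⇒all-free : ∀ i → h i ≡ nothing
      A-free⇒all-free i with coordinate i
      ... | at-var v = var-free v
      ... | at-clause j = clause-free j
      ... | at-chain j = chain-free j
      ... | at-A = hA
      ... | at-B = hB

    tautology⇒free : (∀ y → evalDNF φ y ≡ true) → ∀ i → h i ≡ nothing
    tautology⇒free taut i with h A in hA
    ... | just true = ⊥-elim (A≢true hA)
    ... | just false = case A-off⇒falsifiable hA of λ (y , φy) → case trans (sym (taut y)) φy of λ ()
    ... | nothing = A-free⇒all-free hA i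

  module _ (y : Fin n → Bool) (φy : evalDNF φ y ≡ false) where

    quiescent : Point
    quiescent = state y false false false

    module _ (x : Point) (x≗quiescent : ∀ i → x i ≡ quiescent i) where
      private
        xA : x A ≡ false
        xA = trans (x≗quiescent A) state-A

        xB : x B ≡ false
        xB = trans (x≗quiescent B) state-B

        xC : ∀ j → x (clause j) ≡ false
        xC j = trans (x≗quiescent (clause j)) (state-clause j)

        xH : ∀ j → x (chain j) ≡ false
        xH j = trans (x≗quiescent (chain j)) (state-chain j)

        clause-falsified : ∀ j → evalClause (φ j) (vars x) ≡ false
        clause-falsified j = trans (evalClause-cong (φ j) (λ v → trans (x≗quiescent (var v)) (state-var v))) (evalDNF-false⇒clause φ y φy j)

      ≗quiescent⇒fixed : ∀ i → F x i ≡ x i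
      ≗quiescent⇒fixed i with coordinate i
      ... | at-var v rewrite F-var x v | xA | xB = trans (∨-identityʳ _) (∧-identityʳ _)
      ... | at-clause j rewrite F-clause x j | xA | xB | clause-falsified j | xC j = refl
      ... | at-chain zero = trans (F-chain-zero x) (trans (xC zero) (sym (xH zero)))
      ... | at-chain (suc j) rewrite F-chain-suc x j | xC (suc j) | xH (inject₁ j) | xH (suc j) = refl
      ... | at-A rewrite F-A x | xH (fromℕ k) | xA = refl
      ... | at-B rewrite F-B x | xA | xB = refl

    quiescent-trap : IsTrapSpace F (λ i → just (quiescent i))
    quiescent-trap x x∈quiescent i _ refl = trans (≗quiescent⇒fixed x x≗quiescent i) (x≗quiescent i)
      where
      x≗quiescent : ∀ i → x i ≡ quiescent i
      x≗quiescent i = x∈quiescent i _ refl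

  tautology⇒starUniqueMinimal : (∀ y → evalDNF φ y ≡ true) → StarUniqueMinimal F
  tautology⇒starUniqueMinimal taut = all-free⇒starUniqueMinimal λ _ trap → tautology⇒free trap taut

  starUniqueMinimal⇒tautology : StarUniqueMinimal F → ∀ y → evalDNF φ y ≡ true
  starUniqueMinimal⇒tautology star-unique y with evalDNF φ y in φy
  ... | true = refl
  ... | false = ⊥-elim (starMinimal⇒trap-unfixed (proj₁ star-unique) (quiescent-trap y φy) {B} refl)

-- The hypotheses 1 ≤ n and At-most-3 φ serve the paper's complexity bound, not this equivalence.
lemma3 : (n k : ℕ) → 1 ≤ n → (hk : 1 ≤ k) → (φ : DNF n k) → At-most-3 φ →
    ((∀ (y : Fin n → Bool) → evalDNF φ y ≡ true) ⇔ StarUniqueMinimal (network hk φ))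
lemma3 n (suc k) _ (s≤s z≤n) φ _ = mk⇔ tautology⇒starUniqueMinimal starUniqueMinimal⇒tautology
  where open Network φ
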